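{- Let $H$ and $K$ be finite simplicial complexes and let $m\ge 0$ be an integer. If $H$ is a minor of $K$ (written $H<K$) and $\mathrm{Sm}^m(H)\neq 0$, then $\mathrm{Sm}^m(K)\neq 0$.
   Context: Simplicial complexes are finite abstract simplicial complexes. A set $T$ is a missing face of $K$ if $T\notin K$ but every proper subset of $T$ is in $K$. A map $K\mapsto K'$ is an admissible contraction if $K'$ is obtained from $K$ by identifying two distinct vertices $u,v$ of $K$ such that no missing face of $K$ of dimension $\le \dim K$ contains both $u$ and $v$; explicitly $K'=\{T: u\notin T\in K\}\cup\{(T\setminus\{u\})\cup\{v\}: u\in T\in K\}$. $K\mapsto K'$ is a deletion if $K'$ is a subcomplex of $K$. $H$ is a minor of $K$, $H<K$, if $H$ can be obtained from $K$ by a finite sequence of admissible contractions and deletions. Deleted join: $K*K=\{S^1\uplus T^2: S,T\in K\}$ (superscripts denote two disjoint copies of $K$), and $K_*=\{S^1\uplus T^2: S,T\in K,\ S\cap T=\emptyset\}$, with the involution $\tau(S^1\uplus T^2)=T^1\uplus S^2$, which induces a $\mathbb{Z}_2$-action on the simplicial cochain complex $C^*(K_*;\mathbb{Z}_2)$. Let $C_S(K_*)=\{c: \tau c=c\}$ be the subcomplex of symmetric cochains and $H^*_S(K_*)$ its cohomology. The sequence $0\to C_S(K_*)\to C(K_*)\xrightarrow{\mathrm{id}+\tau} C_S(K_*)\to 0$ is exact, and its long exact cohomology sequence has connecting homomorphism $\mathrm{Sm}: H^q_S(K_*)\to H^{q+1}_S(K_*)$. Let $1_{K_*}$ be the $0$-cochain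 taking value $1$ on every vertex of $K_*$ and $[1_{K_*}]\in H^0_S(K_*)$ its class. The $m$-th Smith class (Van Kampen obstruction) is $\mathrm{Sm}^m(K)=\mathrm{Sm}^m([1_{K_*}])\in H^m_S(K_*;\mathbb{Z}_2)$, where $\mathrm{Sm}^m$ is the $m$-fold composition of $\mathrm{Sm}$. -}

module Defs where

open import Data.Nat using (ℕ; zero; suc; _+_; _≤_)
open import Data.Bool using (Bool; true; false; _∧_; _xor_)
open import Data.Fin using (Fin; zero; suc)
open import Data.Fin.Subset using (Subset; _∈_; _∉_; _⊆_; _⊂_; _-_; _∪_; ⁅_⁆; ∣_∣)
open import Data.Vec using (lookup)
open import Data.Product using (Σ; _×_)
open import Data.Sum using (_⊎_)
open import Relation.Nullary using (¬_)
open import Relation.Binary.PropositionalEquality using (_≡_; _≢_)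

-- Finite abstract simplicial complexes on the ground set Fin n,
-- given as a family of faces (a predicate on subsets of Fin n).

Family : ℕ → Set₁
Family n = Subset n → Set

IsComplex : ∀ {n} → Family n → Set
IsComplex K = ∀ {S T} → T ⊆ S → K S → K T

MissingFace : ∀ {n} → Family n → Subset n → Set
MissingFace K T = ¬ K T × (∀ S → S ⊂ T → K S)

DimLe : ∀ {n} → Family n → Subset n → Set
DimLe K T = Σ (Subset _) (λ S → K S × ∣ T ∣ ≤ ∣ S ∣)

Contract : ∀ {n} → Family n → Fin n → Fin n → Family n
Contract K u v T =
  (u ∉ T × K T) ⊎ Σ (Subset _) (λ S → K S × u ∈ S × T ≡ (S - u) ∪ ⁅ v ⁆)

Admissible : ∀ {n} → Family n → Fin n → Fin n → Set
Admissible K u v =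
  u ≢ v × K ⁅ u ⁆ × K ⁅ v ⁆ ×
  (∀ T → MissingFace K T → DimLe K T → ¬ (u ∈ T × v ∈ T))

data Minor {n} (H : Family n) : Family n → Set₁ where
  done : ∀ {K} → (∀ S → (H S → K S) × (K S → H S)) → Minor H K
  contr : ∀ {K} u v → Admissible K u v → Minor H (Contract K u v) → Minor H K
  del : ∀ {K} (K′ : Family n) → IsComplex K′ → (∀ S → K′ S → K S) →
        Minor H K′ → Minor H K

-- The deleted join K_* : simplices S¹ ⊎ T² with S,T ∈ K, S ∩ T = ∅,
-- encoded by the pair (S , T); its dimension is |S| + |T| - 1.

Disjoint : ∀ {n} → Subset n → Subset n → Set
Disjoint S T = ∀ i → i ∈ S → i ∉ T

Simplex* : ∀ {n} → Family n → ℕ → Subset n → Subset n → Set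
Simplex* K q S T = K S × K T × Disjoint S T × ∣ S ∣ + ∣ T ∣ ≡ suc q

-- Z₂-valued cochains on K_* (a q-cochain is determined by its values
-- on q-simplices; other values are irrelevant).
Cochain : ℕ → Set
Cochain n = Subset n → Subset n → Bool

EqOn : ∀ {n} → Family n → ℕ → Cochain n → Cochain n → Set
EqOn K q c d = ∀ S T → Simplex* K q S T → c S T ≡ d S T

τ : ∀ {n} → Cochain n → Cochain n
τ c S T = c T S

_⊕_ : ∀ {n} → Cochain n → Cochain n → Cochain n
(c ⊕ d) S T = c S T xor d S T

xorSum : ∀ {n} → (Fin n → Bool) → Bool
xorSum {zero} f = false
xorSum {suc n} f = f zero xor xorSum (λ i → f (suc i))

δ : ∀ {n} → Cochain n → Cochain n
δ c S T = xorSum (λ i → (lookup S i ∧ c (S - i) T) xor (lookup T i ∧ c S (T - i)))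

Symmetric : ∀ {n} → Family n → ℕ → Cochain n → Set
Symmetric K q c = EqOn K q (τ c) c

-- SmRep K m c : c is a representing symmetric cocycle of Sm^m(K),
-- obtained by iterating the connecting homomorphism Sm of
-- 0 → C_S → C → C_S → 0 (lift along id+τ, then take δ).
data SmRep {n} (K : Family n) : ℕ → Cochain n → Set where
  base : ∀ c → EqOn K 0 c (λ _ _ → true) → SmRep K 0 c
  step : ∀ {q c} → SmRep K q c → (d : Cochain n) → EqOn K q (d ⊕ τ d) c →
         ∀ e → EqOn K (suc q) e (δ d) → SmRep K (suc q) e

-- c is zero in H^m_S(K_*): a coboundary of a symmetric (m-1)-cochain
SymCoboundary : ∀ {n} → Family n → ℕ → Cochain n → Set
SymCoboundary K zero c = EqOn K 0 c (λ _ _ → false)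
SymCoboundary K (suc q) c =
  Σ (Cochain _) (λ e → Symmetric K q e × EqOn K (suc q) c (δ e))

SmZero : ∀ {n} → Family n → ℕ → Set
SmZero K m = Σ (Cochain _) (λ c → SmRep K m c × SymCoboundary K m c)

SmNonzero : ∀ {n} → Family n → ℕ → Set
SmNonzero K m = ¬ SmZero K m

-- Smith classes are natural: a cochain map C(K_*) → C(K′_*) commuting with τ and
-- fixing the unit cocycle sends a representative of Sm^m(K) to one of Sm^m(K′) and a
-- symmetric coboundary to a symmetric coboundary, so Sm^m(K) = 0 forces Sm^m(K′) = 0
-- along every deletion and admissible contraction K ↦ K′. For a deletion the map is
-- restriction. For the contraction identifying u with v, a simplex S ⊔ T of K′_* not
-- in K_* has, say, S ∉ K, and then v ∈ S and S[v ↦ u] ∈ K. The map keeps c on the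
-- simplices of K_* and elsewhere takes c(S[v ↦ u], T) corrected by δ(P θ c), where
-- θ is a chain homotopy between the identity and the substitution v ↦ u and P keeps
-- only the pairs of faces of K; this makes it commute with δ. The correction only
-- involves sets S[i ↦ u] with S - i ∈ K, and these lie in K because a missing face
-- of K of dimension ≤ dim K cannot contain both u and v. Finally, Sm^m(K) ≠ 0 is a
-- negation, so K may be assumed decidable.

module Submission where

open import Algebra.Bundles using (CommutativeMonoid; CommutativeRing)
open import Data.Bool using (Bool; true; false; _∧_; _∨_; _xor_; not; if_then_else_)
open import Data.Bool.Properties
  using (xor-∧-commutativeRing; ∧-commutativeMonoid; xor-comm; xor-assoc; xor-same; xor-identityʳ;
         ∧-distribˡ-xor; ∧-comm; ∧-zeroʳ; ∨-zeroʳ; ∨-identityʳ; not-involutive;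
         not-distribˡ-xor; not-distribʳ-xor; xor-annihilates-not)
open import Data.Fin using (Fin; zero; suc)
open import Data.Fin.Properties using (suc-injective; _≟_)
open import Data.Fin.Subset using (Subset; _∈_; _∉_; _⊆_; _⊂_; _-_; _∪_; ⁅_⁆; ∣_∣)
open import Data.Fin.Subset.Properties
  using (x∈⁅x⁆; x≢y⇒x∉⁅y⁆; p─⊥≡p; ∪-identityʳ; p─x─y≡p─y─x; p─q⊆p; x∈p∧x≢y⇒x∈p-y;
         p⊆q⇒∣p∣≤∣q∣; _∈?_; p⊆p∪q; x∈p⇒∣p-x∣<∣p∣)
open import Data.Fin.Subset.Induction using (Acc; acc; ⊂-wellFounded)
open import Data.Nat using (ℕ; zero; suc; _+_; _≤_; s≤s)
open import Data.Nat.Properties using (≤-trans; ≤-reflexive; +-comm; m≤m+n; m≤n+m)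
open import Data.Product using (_×_; _,_; proj₁; proj₂)
open import Data.Sum using (inj₁; inj₂)
open import Data.Vec using ([]; _∷_; lookup)
open import Data.Vec.Properties using ([]=⇒lookup; lookup⇒[]=; lookup-zipWith)
open import Data.Vec.Relation.Binary.Pointwise.Extensional using (ext; Pointwise-≡⇒≡)
open import Function using (_∘_)
open import Relation.Nullary using (¬_; Dec; yes; no; does; contradiction)
open import Relation.Nullary.Decidable using (dec-true; _×-dec_; ¬¬-excluded-middle)
open import Relation.Binary.PropositionalEquality

open import Defs

open import Algebra.Properties.CommutativeSemigroup
  (CommutativeRing.+-commutativeSemigroup xor-∧-commutativeRing)
  using () renaming (interchange to xor-interchange)
open import Algebra.Properties.CommutativeSemigroup
  (CommutativeMonoid.commutativeSemigroup ∧-commutativeMonoid)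
  using () renaming (x∙yz≈y∙xz to ∧-left-comm)

-- Sums over Fin n in ℤ₂

xor-cancel-middle : ∀ x a y → (x xor a) xor (a xor y) ≡ x xor y
xor-cancel-middle false false y = refl
xor-cancel-middle false true  y = not-involutive y
xor-cancel-middle true  false y = refl
xor-cancel-middle true  true  y = refl

xor-rearrange : ∀ a b f g → (f xor b) xor ((a xor f) xor g) ≡ a xor (b xor g)
xor-rearrange false b false g = refl
xor-rearrange true  b false g = sym (not-distribʳ-xor b g)
xor-rearrange false b true  g = xor-annihilates-not b g
xor-rearrange true  b true  g = sym (not-distribˡ-xor b g)

xor-solveʳ : ∀ {a} b {x} → a xor b ≡ x → a ≡ x xor b
xor-solveʳ {a} b refl = sym (trans (xor-assoc a b b) (trans (cong (a xor_) (xor-same b)) (xor-identityʳ a)))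

xor≡false⇒≡ : ∀ {a b} → a xor b ≡ false → a ≡ b
xor≡false⇒≡ {false} {false} _ = refl
xor≡false⇒≡ {true}  {true}  _ = refl

xorSum-cong : ∀ {n} {f g : Fin n → Bool} → (∀ i → f i ≡ g i) → xorSum f ≡ xorSum g
xorSum-cong {zero}  f≗g = refl
xorSum-cong {suc n} f≗g = cong₂ _xor_ (f≗g zero) (xorSum-cong (f≗g ∘ suc))

xorSum-false : ∀ {n} {f : Fin n → Bool} → (∀ i → f i ≡ false) → xorSum f ≡ false
xorSum-false {zero}  f≗0 = refl
xorSum-false {suc n} f≗0 = cong₂ _xor_ (f≗0 zero) (xorSum-false (f≗0 ∘ suc))

xorSum-xor : ∀ {n} (f g : Fin n → Bool) →
             xorSum (λ i → f i xor g i) ≡ xorSum f xor xorSum g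
xorSum-xor {zero}  f g = refl
xorSum-xor {suc n} f g =
  trans (cong ((f zero xor g zero) xor_) (xorSum-xor (f ∘ suc) (g ∘ suc)))
        (xor-interchange (f zero) (g zero) _ _)

∧-xorSum : ∀ {n} b (f : Fin n → Bool) → b ∧ xorSum f ≡ xorSum (λ i → b ∧ f i)
∧-xorSum {n} false f = sym (xorSum-false {n} (λ _ → refl))
∧-xorSum true  f = refl

xorSum-point : ∀ {n} {f : Fin n → Bool} k → (∀ i → i ≢ k → f i ≡ false) →
               xorSum f ≡ f k
xorSum-point {f = f} zero f≗0 =
  trans (cong (f zero xor_) (xorSum-false (λ i → f≗0 (suc i) λ ())))
        (xor-identityʳ (f zero))
xorSum-point (suc k) f≗0 =
  cong₂ _xor_ (f≗0 zero λ ()) (xorSum-point k (λ i i≢k → f≗0 (suc i) (i≢k ∘ suc-injective)))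

xorSum-pair : ∀ {n} {f : Fin n → Bool} {u v} → u ≢ v →
              (∀ i → i ≢ u → i ≢ v → f i ≡ false) → xorSum f ≡ f u xor f v
xorSum-pair {u = zero} {zero} u≢v f≗0 = contradiction refl u≢v
xorSum-pair {f = f} {zero} {suc v} u≢v f≗0 =
  cong (f zero xor_) (xorSum-point v (λ i i≢v → f≗0 (suc i) (λ ()) (i≢v ∘ suc-injective)))
xorSum-pair {f = f} {suc u} {zero} u≢v f≗0 =
  trans (cong (f zero xor_) (xorSum-point u (λ i i≢u → f≗0 (suc i) (i≢u ∘ suc-injective) (λ ()))))
        (xor-comm (f zero) (f (suc u)))
xorSum-pair {u = suc u} {suc v} u≢v f≗0 =
  cong₂ _xor_ (f≗0 zero (λ ()) (λ ()))
    (xorSum-pair (u≢v ∘ cong suc)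
      (λ i i≢u i≢v → f≗0 (suc i) (i≢u ∘ suc-injective) (i≢v ∘ suc-injective)))

xorSum-pair-cong : ∀ {n} {f g : Fin n → Bool} {u v} → u ≢ v →
                   (∀ i → i ≢ u → i ≢ v → f i ≡ g i) → f u xor f v ≡ g u xor g v →
                   xorSum f ≡ xorSum g
xorSum-pair-cong {f = f} {g} {u} {v} u≢v f≗g pair = xor≡false⇒≡ (begin
  xorSum f xor xorSum g            ≡⟨ xorSum-xor f g ⟨
  xorSum (λ i → f i xor g i)       ≡⟨ xorSum-pair u≢v f⊕g-off ⟩
  (f u xor g u) xor (f v xor g v)  ≡⟨ xor-interchange (f u) (g u) (f v) (g v) ⟩
  (f u xor f v) xor (g u xor g v)  ≡⟨ cong ((f u xor f v) xor_) pair ⟨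
  (f u xor f v) xor (f u xor f v)  ≡⟨ xor-same (f u xor f v) ⟩
  false                            ∎)
  where
  open ≡-Reasoning
  f⊕g-off : ∀ i → i ≢ u → i ≢ v → f i xor g i ≡ false
  f⊕g-off i i≢u i≢v = trans (cong (f i xor_) (sym (f≗g i i≢u i≢v))) (xor-same (f i))

xorSum-symmetric : ∀ {n} (F : Fin n → Fin n → Bool) → (∀ i j → F i j ≡ F j i) →
                   xorSum (λ i → xorSum (F i)) ≡ xorSum (λ i → F i i)
xorSum-symmetric {zero}  F F-sym = refl
xorSum-symmetric {suc n} F F-sym = begin
  (F zero zero xor row) xor xorSum (λ i → F (suc i) zero xor xorSum (F (suc i) ∘ suc))
    ≡⟨ cong ((F zero zero xor row) xor_) (xorSum-xor (λ i → F (suc i) zero) (xorSum ∘ (_∘ suc) ∘ F ∘ suc)) ⟩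
  (F zero zero xor row) xor (xorSum (λ i → F (suc i) zero) xor rest)
    ≡⟨ cong (λ col → (F zero zero xor row) xor (col xor rest)) (xorSum-cong (λ i → F-sym (suc i) zero)) ⟩
  (F zero zero xor row) xor (row xor rest)
    ≡⟨ xor-cancel-middle (F zero zero) row rest ⟩
  F zero zero xor rest
    ≡⟨ cong (F zero zero xor_) (xorSum-symmetric (λ i j → F (suc i) (suc j)) (λ i j → F-sym _ _)) ⟩
  F zero zero xor xorSum (λ i → F (suc i) (suc i)) ∎
  where
  open ≡-Reasoning
  row rest : Bool
  row  = xorSum (F zero ∘ suc)
  rest = xorSum (λ i → xorSum (F (suc i) ∘ suc))

-- Subsets of Fin n as Boolean vectors

∈⇒lookup : ∀ {n} {p : Subset n} {i} → i ∈ p → lookup p i ≡ true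
∈⇒lookup = []=⇒lookup

lookup⇒∈ : ∀ {n} {p : Subset n} {i} → lookup p i ≡ true → i ∈ p
lookup⇒∈ {p = p} {i} = lookup⇒[]= i p

∉⇒lookup : ∀ {n} {p : Subset n} {i} → i ∉ p → lookup p i ≡ false
∉⇒lookup {p = p} {i} i∉p with lookup p i in eq
... | true  = contradiction (lookup⇒∈ eq) i∉p
... | false = refl

lookup⇒∉ : ∀ {n} {p : Subset n} {i} → lookup p i ≡ false → i ∉ p
lookup⇒∉ pi≡false i∈p with trans (sym (∈⇒lookup i∈p)) pi≡false
... | ()

lookup-ext : ∀ {n} {p q : Subset n} → (∀ i → lookup p i ≡ lookup q i) → p ≡ q
lookup-ext p≗q = Pointwise-≡⇒≡ (ext p≗q)

lookup-⁅⁆-other : ∀ {n} {i j : Fin n} → j ≢ i → lookup ⁅ i ⁆ j ≡ false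
lookup-⁅⁆-other j≢i = ∉⇒lookup (x≢y⇒x∉⁅y⁆ j≢i)

lookup-remove-self : ∀ {n} (p : Subset n) i → lookup (p - i) i ≡ false
lookup-remove-self (x ∷ p) zero    = refl
lookup-remove-self (x ∷ p) (suc i) = lookup-remove-self p i

lookup-remove-other : ∀ {n} (p : Subset n) {i j} → j ≢ i → lookup (p - i) j ≡ lookup p j
lookup-remove-other (x ∷ p) {zero}  {zero}  j≢i = contradiction refl j≢i
lookup-remove-other (x ∷ p) {zero}  {suc j} j≢i = cong (λ q → lookup q j) (p─⊥≡p p)
lookup-remove-other (x ∷ p) {suc i} {zero}  j≢i = refl
lookup-remove-other (x ∷ p) {suc i} {suc j} j≢i = lookup-remove-other p (j≢i ∘ cong suc)

∉-remove-self : ∀ {n} (p : Subset n) i → i ∉ p - i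
∉-remove-self p i = lookup⇒∉ (lookup-remove-self p i)

⊆-remove : ∀ {n} {Y Z : Subset n} {i} → Y ⊆ Z → i ∉ Y → Y ⊆ Z - i
⊆-remove Y⊆Z i∉Y j∈Y = x∈p∧x≢y⇒x∈p-y (Y⊆Z j∈Y) (λ { refl → i∉Y j∈Y })

remove-mono : ∀ {n} {Y Z : Subset n} {i} → Y ⊆ Z → Y - i ⊆ Z - i
remove-mono {Y = Y} {i = i} Y⊆Z j∈Y-i =
  x∈p∧x≢y⇒x∈p-y (Y⊆Z (p─q⊆p Y ⁅ i ⁆ j∈Y-i)) (λ { refl → ∉-remove-self Y i j∈Y-i })

lookup-insert-self : ∀ {n} (p : Subset n) i → lookup (p ∪ ⁅ i ⁆) i ≡ true
lookup-insert-self p i =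
  trans (lookup-zipWith _∨_ i p ⁅ i ⁆) (trans (cong (lookup p i ∨_) (∈⇒lookup (x∈⁅x⁆ i))) (∨-zeroʳ _))

lookup-insert-other : ∀ {n} (p : Subset n) {i j} → j ≢ i → lookup (p ∪ ⁅ i ⁆) j ≡ lookup p j
lookup-insert-other p {i} {j} j≢i =
  trans (lookup-zipWith _∨_ j p ⁅ i ⁆) (trans (cong (lookup p j ∨_) (lookup-⁅⁆-other j≢i)) (∨-identityʳ _))

lookup-remove-absent : ∀ {n} (p : Subset n) i {j} → lookup p j ≡ false → lookup (p - i) j ≡ false
lookup-remove-absent p i {j} pj≡false with j ≟ i
... | yes refl = lookup-remove-self p i
... | no j≢i   = trans (lookup-remove-other p j≢i) pj≡false

insert-remove-self : ∀ {n} (p : Subset n) {i} → lookup p i ≡ false → p ∪ ⁅ i ⁆ - i ≡ p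
insert-remove-self p {i} pi≡false = lookup-ext pointwise
  where
  pointwise : ∀ j → lookup (p ∪ ⁅ i ⁆ - i) j ≡ lookup p j
  pointwise j with j ≟ i
  ... | yes refl = trans (lookup-remove-self (p ∪ ⁅ i ⁆) i) (sym pi≡false)
  ... | no j≢i   = trans (lookup-remove-other (p ∪ ⁅ i ⁆) j≢i) (lookup-insert-other p j≢i)

insert-remove-comm : ∀ {n} (p : Subset n) {i j} → i ≢ j → p ∪ ⁅ j ⁆ - i ≡ (p - i) ∪ ⁅ j ⁆
insert-remove-comm p {i} {j} i≢j = lookup-ext pointwise
  where
  pointwise : ∀ k → lookup (p ∪ ⁅ j ⁆ - i) k ≡ lookup ((p - i) ∪ ⁅ j ⁆) k
  pointwise k with k ≟ i | k ≟ j
  ... | yes refl | _        = trans (lookup-remove-self (p ∪ ⁅ j ⁆) k)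
                                    (sym (trans (lookup-insert-other (p - k) i≢j) (lookup-remove-self p k)))
  ... | no k≢i   | yes refl = trans (lookup-remove-other (p ∪ ⁅ j ⁆) k≢i)
                                    (trans (lookup-insert-self p k) (sym (lookup-insert-self (p - i) k)))
  ... | no k≢i   | no k≢j   = trans (lookup-remove-other (p ∪ ⁅ j ⁆) k≢i)
                                    (trans (lookup-insert-other p k≢j)
                                    (sym (trans (lookup-insert-other (p - i) k≢j) (lookup-remove-other p k≢i))))

suc∣p-i∣≡∣p∣ : ∀ {n} (p : Subset n) {i} → lookup p i ≡ true → suc ∣ p - i ∣ ≡ ∣ p ∣
suc∣p-i∣≡∣p∣ (true  ∷ p) {zero}  refl = cong (suc ∘ ∣_∣) (p─⊥≡p p)
suc∣p-i∣≡∣p∣ (false ∷ p) {suc i} i∈p  = suc∣p-i∣≡∣p∣ p i∈p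
suc∣p-i∣≡∣p∣ (true  ∷ p) {suc i} i∈p  = cong suc (suc∣p-i∣≡∣p∣ p i∈p)

∣p∪⁅i⁆∣≡suc∣p∣ : ∀ {n} (p : Subset n) {i} → lookup p i ≡ false → ∣ p ∪ ⁅ i ⁆ ∣ ≡ suc ∣ p ∣
∣p∪⁅i⁆∣≡suc∣p∣ (false ∷ p) {zero}  refl = cong (suc ∘ ∣_∣) (∪-identityʳ p)
∣p∪⁅i⁆∣≡suc∣p∣ (false ∷ p) {suc i} i∉p  = ∣p∪⁅i⁆∣≡suc∣p∣ p i∉p
∣p∪⁅i⁆∣≡suc∣p∣ (true  ∷ p) {suc i} i∉p  = cong suc (∣p∪⁅i⁆∣≡suc∣p∣ p i∉p)

-- The coboundary on pairs of subsets

∧-congˡ-true : ∀ b {x y} → (b ≡ true → x ≡ y) → b ∧ x ≡ b ∧ y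
∧-congˡ-true false x≡y = refl
∧-congˡ-true true  x≡y = x≡y refl

faceTerm : ∀ {n} → Cochain n → Subset n → Subset n → Fin n → Bool
faceTerm c S T i = (lookup S i ∧ c (S - i) T) xor (lookup T i ∧ c S (T - i))

δ-xor : ∀ {n} (c d : Cochain n) S T → δ (c ⊕ d) S T ≡ δ c S T xor δ d S T
δ-xor {n} c d S T = trans (xorSum-cong {n} distrib) (xorSum-xor (faceTerm c S T) (faceTerm d S T))
  where
  distrib : ∀ i → faceTerm (c ⊕ d) S T i ≡ faceTerm c S T i xor faceTerm d S T i
  distrib i = trans (cong₂ _xor_ (∧-distribˡ-xor (lookup S i) _ _) (∧-distribˡ-xor (lookup T i) _ _))
                    (xor-interchange (lookup S i ∧ c (S - i) T) (lookup S i ∧ d (S - i) T)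
                                     (lookup T i ∧ c S (T - i)) (lookup T i ∧ d S (T - i)))

δ-cong : ∀ {n} (c d : Cochain n) S T →
         (∀ i → lookup S i ≡ true → c (S - i) T ≡ d (S - i) T) →
         (∀ i → lookup T i ≡ true → c S (T - i) ≡ d S (T - i)) →
         δ c S T ≡ δ d S T
δ-cong c d S T eqˡ eqʳ =
  xorSum-cong (λ i → cong₂ _xor_ (∧-congˡ-true (lookup S i) (eqˡ i)) (∧-congˡ-true (lookup T i) (eqʳ i)))

infix 4 _≐_
_≐_ : ∀ {n} → Cochain n → Cochain n → Set
c ≐ d = ∀ S T → c S T ≡ d S T

δ-cong-≐ : ∀ {n} {c d : Cochain n} → c ≐ d → δ c ≐ δ d
δ-cong-≐ {c = c} {d} c≐d S T = δ-cong c d S T (λ i _ → c≐d (S - i) T) (λ i _ → c≐d S (T - i))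

δ-false : ∀ {n} (c : Cochain n) S T →
          (∀ i → c (S - i) T ≡ false) → (∀ i → c S (T - i) ≡ false) → δ c S T ≡ false
δ-false c S T c≡0ˡ c≡0ʳ = xorSum-false (λ i →
  cong₂ _xor_ (trans (cong (lookup S i ∧_) (c≡0ˡ i)) (∧-zeroʳ _))
              (trans (cong (lookup T i ∧_) (c≡0ʳ i)) (∧-zeroʳ _)))

δ-τ : ∀ {n} (c : Cochain n) S T → δ (τ c) S T ≡ δ c T S
δ-τ {n} c S T = xorSum-cong {n} (λ i → xor-comm (lookup S i ∧ c T (S - i)) (lookup T i ∧ c (T - i) S))

lookup-remove-swap : ∀ {n} (S : Subset n) (f : Subset n → Bool) i j →
                     lookup S i ∧ (lookup (S - i) j ∧ f (S - i - j))
                     ≡ lookup S j ∧ (lookup (S - j) i ∧ f (S - j - i))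
lookup-remove-swap S f i j with i ≟ j
... | yes refl = refl
... | no i≢j
  rewrite lookup-remove-other S (i≢j ∘ sym) | lookup-remove-other S i≢j | p─x─y≡p─y─x S i j
  = ∧-left-comm (lookup S i) (lookup S j) _

δ-δ : ∀ {n} (c : Cochain n) S T → δ (δ c) S T ≡ false
δ-δ {n} c S T = begin
  δ (δ c) S T                  ≡⟨ xorSum-cong expand ⟩
  xorSum (λ i → xorSum (G i))  ≡⟨ xorSum-symmetric G G-sym ⟩
  xorSum (λ i → G i i)         ≡⟨ xorSum-false G-diag ⟩
  false                        ∎
  where
  open ≡-Reasoning
  A B C D G : Fin n → Fin n → Bool
  A i j = lookup S i ∧ (lookup (S - i) j ∧ c (S - i - j) T)
  B i j = lookup S i ∧ (lookup T j ∧ c (S - i) (T - j))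
  C i j = lookup T i ∧ (lookup S j ∧ c (S - j) (T - i))
  D i j = lookup T i ∧ (lookup (T - i) j ∧ c S (T - i - j))
  G i j = (A i j xor B i j) xor (C i j xor D i j)

  distribute : ∀ b (f g : Fin n → Bool) →
               b ∧ xorSum (λ j → f j xor g j) ≡ xorSum (λ j → (b ∧ f j) xor (b ∧ g j))
  distribute b f g =
    trans (∧-xorSum b (λ j → f j xor g j)) (xorSum-cong {n} (λ j → ∧-distribˡ-xor b (f j) (g j)))

  expand : ∀ i → faceTerm (δ c) S T i ≡ xorSum (G i)
  expand i = begin
    faceTerm (δ c) S T i
      ≡⟨ cong₂ _xor_ (distribute (lookup S i) (λ j → lookup (S - i) j ∧ c (S - i - j) T)
                                              (λ j → lookup T j ∧ c (S - i) (T - j)))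
                     (distribute (lookup T i) (λ j → lookup S j ∧ c (S - j) (T - i))
                                              (λ j → lookup (T - i) j ∧ c S (T - i - j))) ⟩
    xorSum (λ j → A i j xor B i j) xor xorSum (λ j → C i j xor D i j)
      ≡⟨ xorSum-xor (λ j → A i j xor B i j) (λ j → C i j xor D i j) ⟨
    xorSum (G i) ∎

  C≡Bᵀ : ∀ i j → C i j ≡ B j i
  C≡Bᵀ i j = ∧-left-comm (lookup T i) (lookup S j) _

  G-sym : ∀ i j → G i j ≡ G j i
  G-sym i j = begin
    (A i j xor B i j) xor (C i j xor D i j)
      ≡⟨ cong₂ (λ a d → (a xor B i j) xor (C i j xor d))
               (lookup-remove-swap S (λ X → c X T) i j) (lookup-remove-swap T (c S) i j) ⟩
    (A j i xor B i j) xor (C i j xor D j i)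
      ≡⟨ cong₂ (λ b c → (A j i xor b) xor (c xor D j i)) (sym (C≡Bᵀ j i)) (C≡Bᵀ i j) ⟩
    (A j i xor C j i) xor (B j i xor D j i)
      ≡⟨ xor-interchange (A j i) (C j i) (B j i) (D j i) ⟩
    G j i ∎

  G-diag : ∀ i → G i i ≡ false
  G-diag i = begin
    (A i i xor B i i) xor (C i i xor D i i)
      ≡⟨ cong₂ (λ a d → (a xor B i i) xor (C i i xor d))
               (trans (cong (λ b → lookup S i ∧ (b ∧ c (S - i - i) T)) (lookup-remove-self S i)) (∧-zeroʳ _))
               (trans (cong (λ b → lookup T i ∧ (b ∧ c S (T - i - i))) (lookup-remove-self T i)) (∧-zeroʳ _)) ⟩
    (false xor B i i) xor (C i i xor false)
      ≡⟨ cong (λ c → (false xor B i i) xor (c xor false)) (C≡Bᵀ i i) ⟩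
    (false xor B i i) xor (B i i xor false)
      ≡⟨ xor-cancel-middle false (B i i) false ⟩
    false ∎

-- Equivariant cochain maps

module _ {n} {K : Family n} {q : ℕ} where

  EqOn-sym : ∀ {c d} → EqOn K q c d → EqOn K q d c
  EqOn-sym c≈d S T s = sym (c≈d S T s)

  EqOn-trans : ∀ {c d e} → EqOn K q c d → EqOn K q d e → EqOn K q c e
  EqOn-trans c≈d d≈e S T s = trans (c≈d S T s) (d≈e S T s)

  EqOn-xorˡ : ∀ {c d} e → EqOn K q c d → EqOn K q (e ⊕ c) (e ⊕ d)
  EqOn-xorˡ e c≈d S T s = cong (e S T xor_) (c≈d S T s)

  Simplex*-sym : ∀ {S T} → Simplex* K q S T → Simplex* K q T S
  Simplex*-sym {S} {T} (kS , kT , S∩T≡∅ , size) =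
    kT , kS , (λ i i∈T i∈S → S∩T≡∅ i i∈S i∈T) , trans (+-comm ∣ T ∣ ∣ S ∣) size

  EqOn-τ : ∀ {c d} → EqOn K q c d → EqOn K q (τ c) (τ d)
  EqOn-τ c≈d S T s = c≈d T S (Simplex*-sym s)

-- map-vertex is how the unit cocycle of K_* is sent to that of K′_*.
record EquivariantCochainMap {n} (K K′ : Family n) : Set₁ where
  field
    map        : Cochain n → Cochain n
    map-cong   : ∀ {q c d} → EqOn K q c d → EqOn K′ q (map c) (map d)
    map-xor    : ∀ {q} c d → EqOn K′ q (map (c ⊕ d)) (map c ⊕ map d)
    map-τ      : ∀ {q} c → EqOn K′ q (map (τ c)) (τ (map c))
    map-δ      : ∀ {q} c → EqOn K′ q (δ (map c)) (map (δ c))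
    map-vertex : ∀ {c d} → EqOn K 0 c d → EqOn K′ 0 (map c) d

module _ {n} {K K′ : Family n} (Φ : EquivariantCochainMap K K′) where
  open EquivariantCochainMap Φ

  map-SmRep : ∀ {q c} → SmRep K q c → SmRep K′ q (map c)
  map-SmRep (base c c≈1) = base (map c) (map-vertex c≈1)
  map-SmRep (step {q} {c} rep d d+τd≈c e e≈δd) =
    step (map-SmRep rep) (map d)
      (EqOn-trans (EqOn-xorˡ (map d) (EqOn-sym (map-τ d)))
        (EqOn-trans (EqOn-sym (map-xor d (τ d))) (map-cong d+τd≈c)))
      (map e) (EqOn-trans (map-cong e≈δd) (EqOn-sym (map-δ d)))

  map-SymCoboundary : ∀ q {c} → SymCoboundary K q c → SymCoboundary K′ q (map c)
  map-SymCoboundary zero    c≈0 = map-vertex c≈0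
  map-SymCoboundary (suc q) (e , e-sym , c≈δe) =
    map e , EqOn-trans (EqOn-sym (map-τ e)) (map-cong e-sym) ,
    EqOn-trans (map-cong c≈δe) (EqOn-sym (map-δ e))

  map-SmZero : ∀ m → SmZero K m → SmZero K′ m
  map-SmZero m (c , rep , c≈0) = map c , map-SmRep rep , map-SymCoboundary m c≈0

restriction : ∀ {n} {K K′ : Family n} → (∀ S → K′ S → K S) → EquivariantCochainMap K K′
restriction {K = K} {K′} K′⊆K = record
  { map        = λ c → c
  ; map-cong   = restrict
  ; map-xor    = λ _ _ _ _ _ → refl
  ; map-τ      = λ _ _ _ _ → refl
  ; map-δ      = λ _ _ _ _ → refl
  ; map-vertex = restrict
  }
  where
  restrict : ∀ {q c d} → EqOn K q c d → EqOn K′ q c d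
  restrict c≈d S T (kS , kT , S∩T≡∅ , size) = c≈d S T (K′⊆K S kS , K′⊆K T kT , S∩T≡∅ , size)

-- Admissible contractions

infixl 5 _⟨_↦_⟩
_⟨_↦_⟩ : ∀ {n} → Subset n → Fin n → Fin n → Subset n
X ⟨ i ↦ j ⟩ = (X - i) ∪ ⁅ j ⁆

lookup-≢ : ∀ {n} (X : Subset n) {i j} → lookup X i ≡ true → lookup X j ≡ false → i ≢ j
lookup-≢ X Xi Xj refl = lookup⇒∉ Xj (lookup⇒∈ {p = X} Xi)

module _ {n} (X : Subset n) {i j : Fin n} where

  lookup-exchange-target : lookup (X ⟨ i ↦ j ⟩) j ≡ true
  lookup-exchange-target = lookup-insert-self (X - i) j

  lookup-exchange-source : i ≢ j → lookup (X ⟨ i ↦ j ⟩) i ≡ false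
  lookup-exchange-source i≢j = trans (lookup-insert-other (X - i) i≢j) (lookup-remove-self X i)

  lookup-exchange-other : ∀ {k} → k ≢ i → k ≢ j → lookup (X ⟨ i ↦ j ⟩) k ≡ lookup X k
  lookup-exchange-other k≢i k≢j = trans (lookup-insert-other (X - i) k≢j) (lookup-remove-other X k≢i)

  ∉-exchange-source : i ≢ j → i ∉ X ⟨ i ↦ j ⟩
  ∉-exchange-source i≢j = lookup⇒∉ (lookup-exchange-source i≢j)

  ∈-exchange⁻ : ∀ {k} → k ∈ X ⟨ i ↦ j ⟩ → k ≢ j → k ∈ X × k ≢ i
  ∈-exchange⁻ {k} k∈ k≢j with k ≟ i
  ... | yes refl = contradiction k∈ (∉-exchange-source k≢j)
  ... | no k≢i   = lookup⇒∈ (trans (sym (lookup-exchange-other k≢i k≢j)) (∈⇒lookup k∈)) , k≢i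

exchange-inverse : ∀ {n} (X : Subset n) {i j} →
                   lookup X i ≡ true → lookup X j ≡ false → X ⟨ i ↦ j ⟩ ⟨ j ↦ i ⟩ ≡ X
exchange-inverse X {i} {j} Xi Xj = lookup-ext pointwise
  where
  i≢j : i ≢ j
  i≢j = lookup-≢ X Xi Xj
  pointwise : ∀ k → lookup (X ⟨ i ↦ j ⟩ ⟨ j ↦ i ⟩) k ≡ lookup X k
  pointwise k with k ≟ i | k ≟ j
  ... | yes refl | _        = trans (lookup-exchange-target (X ⟨ i ↦ j ⟩)) (sym Xi)
  ... | no k≢i   | yes refl = trans (lookup-exchange-source (X ⟨ i ↦ j ⟩) (i≢j ∘ sym)) (sym Xj)
  ... | no k≢i   | no k≢j   =
    trans (lookup-exchange-other (X ⟨ i ↦ j ⟩) k≢j k≢i) (lookup-exchange-other X k≢i k≢j)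

∣exchange∣ : ∀ {n} (X : Subset n) {i j} →
             lookup X i ≡ true → lookup X j ≡ false → ∣ X ⟨ i ↦ j ⟩ ∣ ≡ ∣ X ∣
∣exchange∣ X Xi Xj =
  trans (∣p∪⁅i⁆∣≡suc∣p∣ (X - _) (trans (lookup-remove-other X (lookup-≢ X Xi Xj ∘ sym)) Xj))
        (suc∣p-i∣≡∣p∣ X Xi)

exchange-back-⊆ : ∀ {n} {S T : Subset n} {u v} → u ∈ S → T ⊆ S ⟨ u ↦ v ⟩ → T ⟨ v ↦ u ⟩ ⊆ S
exchange-back-⊆ {T = T} {u} {v} u∈S T⊆ {k} k∈ with k ≟ u
... | yes refl = u∈S
... | no k≢u   = let k∈T , k≢v = ∈-exchange⁻ T k∈ k≢u in proj₁ (∈-exchange⁻ _ (T⊆ k∈T) k≢v)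

exchange-remove-⊆ : ∀ {n} (S : Subset n) {i j k} → S ⟨ i ↦ j ⟩ - k ⊆ S ⟨ k ↦ j ⟩
exchange-remove-⊆ S {i} {j} {k} {x} x∈ with x ≟ j
... | yes refl = lookup⇒∈ (lookup-exchange-target S)
... | no x≢j   = p⊆p∪q ⁅ j ⁆ (x∈p∧x≢y⇒x∈p-y (proj₁ (∈-exchange⁻ S (p─q⊆p (S ⟨ i ↦ j ⟩) ⁅ k ⁆ x∈) x≢j))
                                            (λ { refl → ∉-remove-self (S ⟨ i ↦ j ⟩) x x∈ }))

exchange-disjoint : ∀ {n} {S T : Subset n} {i j} → Disjoint S T → j ∉ T → Disjoint (S ⟨ i ↦ j ⟩) T
exchange-disjoint {S = S} {j = j} S∩T≡∅ j∉T k k∈ k∈T with k ≟ j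
... | yes refl = j∉T k∈T
... | no k≢j   = S∩T≡∅ k (proj₁ (∈-exchange⁻ S k∈ k≢j)) k∈T

Contract-closed : ∀ {n} {K : Family n} {u v} → IsComplex K → u ≢ v → IsComplex (Contract K u v)
Contract-closed K-closed u≢v T′⊆T (inj₁ (u∉T , kT)) = inj₁ (u∉T ∘ T′⊆T , K-closed T′⊆T kT)
Contract-closed {u = u} {v} K-closed u≢v {T = T′} T′⊆T (inj₂ (S , kS , u∈S , refl)) with v ∈? T′
... | no v∉T′  = inj₁ (∉-exchange-source S u≢v ∘ T′⊆T ,
                       K-closed (λ k∈T′ → proj₁ (∈-exchange⁻ S (T′⊆T k∈T′) (λ { refl → v∉T′ k∈T′ }))) kS)
... | yes v∈T′ = inj₂ (T′ ⟨ v ↦ u ⟩ , K-closed (exchange-back-⊆ u∈S T′⊆T) kS ,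
                       lookup⇒∈ (lookup-exchange-target T′) ,
                       sym (exchange-inverse T′ (∈⇒lookup v∈T′) (∉⇒lookup (∉-exchange-source S u≢v ∘ T′⊆T))))

-- The only use of admissibility: otherwise a minimal such Z would be a missing face
-- of K of dimension ≤ dim K containing u and v.
module _ {n} {K : Family n} (K-closed : IsComplex K) (K? : ∀ S → Dec (K S))
         {u v : Fin n} (adm : Admissible K u v) where

  admissible-fill : ∀ Z → u ∈ Z → v ∈ Z → K (Z - u) → K (Z - v) → DimLe K Z → K Z
  admissible-fill Z = fill Z (⊂-wellFounded Z)
    where
    no-missing-face : ∀ T → MissingFace K T → DimLe K T → ¬ (u ∈ T × v ∈ T)
    no-missing-face = proj₂ (proj₂ (proj₂ adm))

    fill : ∀ Z → Acc _⊂_ Z → u ∈ Z → v ∈ Z → K (Z - u) → K (Z - v) → DimLe K Z → K Z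
    fill Z (acc rec) u∈Z v∈Z kZ-u kZ-v (F , kF , ∣Z∣≤∣F∣) with K? Z
    ... | yes kZ = kZ
    ... | no ¬kZ = contradiction (u∈Z , v∈Z) (no-missing-face Z (¬kZ , proper) (F , kF , ∣Z∣≤∣F∣))
      where
      proper : ∀ Y → Y ⊂ Z → K Y
      proper Y Y⊂Z@(Y⊆Z , _) with u ∈? Y | v ∈? Y
      ... | no u∉Y  | _       = K-closed (⊆-remove Y⊆Z u∉Y) kZ-u
      ... | yes _   | no v∉Y  = K-closed (⊆-remove Y⊆Z v∉Y) kZ-v
      ... | yes u∈Y | yes v∈Y =
        fill Y (rec Y⊂Z) u∈Y v∈Y (K-closed (remove-mono Y⊆Z) kZ-u) (K-closed (remove-mono Y⊆Z) kZ-v)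
             (F , kF , ≤-trans (p⊆q⇒∣p∣≤∣q∣ Y⊆Z) ∣Z∣≤∣F∣)

module Contraction {n} {K : Family n} (K-closed : IsComplex K) (K? : ∀ S → Dec (K S))
                   {u v : Fin n} (adm : Admissible K u v) where

  u≢v : u ≢ v
  u≢v = proj₁ adm

  v≢u : v ≢ u
  v≢u = u≢v ∘ sym

  inK₂ : Subset n → Subset n → Bool
  inK₂ S T = does (K? S) ∧ does (K? T)

  inK₂-true : ∀ {S T} → K S → K T → inK₂ S T ≡ true
  inK₂-true {S} {T} kS kT rewrite dec-true (K? S) kS | dec-true (K? T) kT = refl

  inK₂-false : ∀ {S T} → ¬ (K S × K T) → inK₂ S T ≡ false
  inK₂-false {S} {T} ¬kST with K? S | K? T
  ... | yes kS | yes kT = contradiction (kS , kT) ¬kST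
  ... | yes _  | no _   = refl
  ... | no _   | _      = refl

  P Q : Cochain n → Cochain n
  P c S T = inK₂ S T ∧ c S T
  Q c S T = not (inK₂ S T) ∧ c S T

  ρ : Subset n → Subset n
  ρ X = if lookup X v then X ⟨ v ↦ u ⟩ else X

  ρ* : Cochain n → Cochain n
  ρ* c S T = c (ρ S) (ρ T)

  θ : Cochain n → Cochain n
  θ c S T = if lookup S v then c (S ∪ ⁅ u ⁆) T else if lookup T v then c S (T ∪ ⁅ u ⁆) else false

  Λ : Cochain n → Cochain n
  Λ c = P c ⊕ Q (ρ* c ⊕ δ (P (θ c)))

  P-notInK : ∀ c {S T} → ¬ (K S × K T) → P c S T ≡ false
  P-notInK c ¬kST = cong (_∧ _) (inK₂-false ¬kST)

  Q-inK : ∀ c {S T} → K S → K T → Q c S T ≡ false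
  Q-inK c kS kT = cong (λ b → not b ∧ _) (inK₂-true kS kT)

  P-xor : ∀ c d → P (c ⊕ d) ≐ P c ⊕ P d
  P-xor c d S T = ∧-distribˡ-xor (inK₂ S T) (c S T) (d S T)

  Q-xor : ∀ c d → Q (c ⊕ d) ≐ Q c ⊕ Q d
  Q-xor c d S T = ∧-distribˡ-xor (not (inK₂ S T)) (c S T) (d S T)

  P⊕Q : ∀ c → c ≐ P c ⊕ Q c
  P⊕Q c S T with inK₂ S T
  ... | true  = sym (xor-identityʳ (c S T))
  ... | false = refl

  Q≐id⊕P : ∀ c → Q c ≐ c ⊕ P c
  Q≐id⊕P c S T with inK₂ S T
  ... | true  = sym (xor-same (c S T))
  ... | false = sym (xor-identityʳ (c S T))

  P-τ : ∀ c → P (τ c) ≐ τ (P c)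
  P-τ c S T = cong (_∧ c T S) (∧-comm (does (K? S)) (does (K? T)))

  Λ-inK : ∀ c {S T} → K S → K T → Λ c S T ≡ c S T
  Λ-inK c {S} {T} kS kT rewrite inK₂-true kS kT = xor-identityʳ (c S T)

  Λ-notInK : ∀ c {S T} → ¬ (K S × K T) → Λ c S T ≡ ρ* c S T xor δ (P (θ c)) S T
  Λ-notInK c ¬kST rewrite inK₂-false ¬kST = refl

  ρ-v∈ : ∀ {X} → lookup X v ≡ true → ρ X ≡ X ⟨ v ↦ u ⟩
  ρ-v∈ Xv rewrite Xv = refl

  ρ-v∉ : ∀ {X} → lookup X v ≡ false → ρ X ≡ X
  ρ-v∉ Xv rewrite Xv = refl

  lookup-ρ-v : ∀ X → lookup (ρ X) v ≡ false
  lookup-ρ-v X with lookup X v in Xv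
  ... | true  = lookup-exchange-source X v≢u
  ... | false = Xv

  lookup-ρ-u : ∀ X → lookup X u ≡ false → lookup (ρ X) u ≡ lookup X v
  lookup-ρ-u X Xu with lookup X v
  ... | true  = lookup-exchange-target X
  ... | false = Xu

  lookup-ρ-other : ∀ X {i} → i ≢ u → i ≢ v → lookup (ρ X) i ≡ lookup X i
  lookup-ρ-other X i≢u i≢v with lookup X v
  ... | true  = lookup-exchange-other X i≢v i≢u
  ... | false = refl

  ρ-remove : ∀ X {i} → i ≢ u → i ≢ v → ρ (X - i) ≡ ρ X - i
  ρ-remove X {i} i≢u i≢v with lookup X v in Xv
  ... | true  = trans (ρ-v∈ (trans (lookup-remove-other X (i≢v ∘ sym)) Xv))
                      (trans (cong (_∪ ⁅ u ⁆) (p─x─y≡p─y─x X i v)) (sym (insert-remove-comm (X - v) i≢u)))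
  ... | false = ρ-v∉ (trans (lookup-remove-other X (i≢v ∘ sym)) Xv)

  ρ-remove-v : ∀ X → ρ (X - v) ≡ X - v
  ρ-remove-v X = ρ-v∉ (lookup-remove-self X v)

  ρ-remove-u : ∀ {X} → lookup X u ≡ false → lookup X v ≡ true → ρ X - u ≡ X - v
  ρ-remove-u {X} Xu Xv =
    trans (cong (_- u) (ρ-v∈ Xv)) (insert-remove-self (X - v) (trans (lookup-remove-other X u≢v) Xu))

  θ-v∈ˡ : ∀ c S T → lookup S v ≡ true → θ c S T ≡ c (S ∪ ⁅ u ⁆) T
  θ-v∈ˡ c S T Sv rewrite Sv = refl

  θ-v∈ʳ : ∀ c S T → lookup S v ≡ false → lookup T v ≡ true → θ c S T ≡ c S (T ∪ ⁅ u ⁆)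
  θ-v∈ʳ c S T Sv Tv rewrite Sv | Tv = refl

  θ-v∉ : ∀ c S T → lookup S v ≡ false → lookup T v ≡ false → θ c S T ≡ false
  θ-v∉ c S T Sv Tv rewrite Sv | Tv = refl

  θ-cong : ∀ {c d} → c ≐ d → θ c ≐ θ d
  θ-cong c≐d S T with lookup S v | lookup T v
  ... | true  | _     = c≐d _ _
  ... | false | true  = c≐d _ _
  ... | false | false = refl

  θ-xor : ∀ c d → θ (c ⊕ d) ≐ θ c ⊕ θ d
  θ-xor c d S T with lookup S v | lookup T v
  ... | true  | _     = refl
  ... | false | true  = refl
  ... | false | false = refl

  Dom : Subset n → Subset n → Set
  Dom S T = u ∉ S × u ∉ T × ¬ (v ∈ S × v ∈ T)

  Dom-faceˡ : ∀ {S T} i → Dom S T → Dom (S - i) T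
  Dom-faceˡ {S} i (u∉S , u∉T , ¬v∈S,T) =
    u∉S ∘ p─q⊆p S ⁅ i ⁆ , u∉T , λ (v∈S-i , v∈T) → ¬v∈S,T (p─q⊆p S ⁅ i ⁆ v∈S-i , v∈T)

  Dom-faceʳ : ∀ {S T} i → Dom S T → Dom S (T - i)
  Dom-faceʳ {T = T} i (u∉S , u∉T , ¬v∈S,T) =
    u∉S , u∉T ∘ p─q⊆p T ⁅ i ⁆ , λ (v∈S , v∈T-i) → ¬v∈S,T (v∈S , p─q⊆p T ⁅ i ⁆ v∈T-i)

  Dom-sym : ∀ {S T} → Dom S T → Dom T S
  Dom-sym (u∉S , u∉T , ¬v∈S,T) = u∉T , u∉S , λ (v∈T , v∈S) → ¬v∈S,T (v∈S , v∈T)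

  data VSide (S T : Subset n) : Set where
    v∈ˡ : lookup S v ≡ true  → lookup T v ≡ false → VSide S T
    v∈ʳ : lookup S v ≡ false → lookup T v ≡ true  → VSide S T
    v∉  : lookup S v ≡ false → lookup T v ≡ false → VSide S T

  vSide : ∀ {S T} → Dom S T → VSide S T
  vSide {S} {T} (_ , _ , ¬v∈S,T) with lookup S v in Sv | lookup T v in Tv
  ... | true  | true  = contradiction (lookup⇒∈ Sv , lookup⇒∈ Tv) ¬v∈S,T
  ... | true  | false = v∈ˡ Sv Tv
  ... | false | true  = v∈ʳ Sv Tv
  ... | false | false = v∉ Sv Tv

  θ-τ : ∀ c {S T} → Dom S T → θ (τ c) S T ≡ θ c T S
  θ-τ c {S} {T} dom with vSide dom
  ... | v∈ˡ Sv Tv = trans (θ-v∈ˡ (τ c) S T Sv) (sym (θ-v∈ʳ c T S Tv Sv))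
  ... | v∈ʳ Sv Tv = trans (θ-v∈ʳ (τ c) S T Sv Tv) (sym (θ-v∈ˡ c T S Tv))
  ... | v∉  Sv Tv = trans (θ-v∉ (τ c) S T Sv Tv) (sym (θ-v∉ c T S Tv Sv))

  δ-ρ* : ∀ c {S T} → u ∉ S → u ∉ T → δ (ρ* c) S T ≡ ρ* (δ c) S T
  δ-ρ* c {S} {T} u∉S u∉T =
    xorSum-pair-cong {f = faceTerm (ρ* c) S T} {g = faceTerm c (ρ S) (ρ T)} u≢v off-pair on-pair
    where
    Su : lookup S u ≡ false
    Su = ∉⇒lookup u∉S
    Tu : lookup T u ≡ false
    Tu = ∉⇒lookup u∉T

    off-pair : ∀ i → i ≢ u → i ≢ v → faceTerm (ρ* c) S T i ≡ faceTerm c (ρ S) (ρ T) i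
    off-pair i i≢u i≢v = cong₂ _xor_
      (cong₂ _∧_ (sym (lookup-ρ-other S i≢u i≢v)) (cong (λ X → c X (ρ T)) (ρ-remove S i≢u i≢v)))
      (cong₂ _∧_ (sym (lookup-ρ-other T i≢u i≢v)) (cong (c (ρ S)) (ρ-remove T i≢u i≢v)))

    -- the v-faces of (S , T) become the u-faces of (ρ S , ρ T)
    on-pair : faceTerm (ρ* c) S T u xor faceTerm (ρ* c) S T v
              ≡ faceTerm c (ρ S) (ρ T) u xor faceTerm c (ρ S) (ρ T) v
    on-pair rewrite Su | Tu | lookup-ρ-v S | lookup-ρ-v T | lookup-ρ-u S Su | lookup-ρ-u T Tu
                  | ρ-remove-v S | ρ-remove-v T =
      trans (cong₂ _xor_
               (∧-congˡ-true (lookup S v) (λ Sv → cong (λ X → c X (ρ T)) (sym (ρ-remove-u Su Sv))))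
               (∧-congˡ-true (lookup T v) (λ Tv → cong (c (ρ S)) (sym (ρ-remove-u Tu Tv)))))
            (sym (xor-identityʳ _))

  HomotopyFormula : Cochain n → Subset n → Subset n → Set
  HomotopyFormula c S T = θ (δ c) S T xor δ (θ c) S T ≡ c S T xor ρ* c S T

  θ-homotopy-v∈ˡ : ∀ c {S T} → lookup S u ≡ false → lookup T u ≡ false →
                   lookup S v ≡ true → lookup T v ≡ false → HomotopyFormula c S T
  θ-homotopy-v∈ˡ c {S} {T} Su Tu Sv Tv = begin
    θ (δ c) S T xor δ (θ c) S T  ≡⟨ cong (_xor δ (θ c) S T) (θ-v∈ˡ (δ c) S T Sv) ⟩
    δ c S⁺ T xor δ (θ c) S T     ≡⟨ xorSum-xor (faceTerm c S⁺ T) (faceTerm (θ c) S T) ⟨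
    xorSum g                     ≡⟨ xorSum-pair u≢v g-off ⟩
    g u xor g v                  ≡⟨ cong₂ _xor_ g-u g-v ⟩
    c S T xor ρ* c S T           ∎
    where
    open ≡-Reasoning
    S⁺ : Subset n
    S⁺ = S ∪ ⁅ u ⁆
    g : Fin n → Bool
    g i = faceTerm c S⁺ T i xor faceTerm (θ c) S T i

    g-off : ∀ i → i ≢ u → i ≢ v → g i ≡ false
    g-off i i≢u i≢v
      rewrite lookup-insert-other S i≢u | insert-remove-comm S i≢u
            | θ-v∈ˡ c (S - i) T (trans (lookup-remove-other S (i≢v ∘ sym)) Sv) | θ-v∈ˡ c S (T - i) Sv
      = xor-same ((lookup S i ∧ c ((S - i) ∪ ⁅ u ⁆) T) xor (lookup T i ∧ c S⁺ (T - i)))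

    g-u : g u ≡ c S T
    g-u rewrite lookup-insert-self S u | insert-remove-self S Su | Su | Tu =
      trans (xor-identityʳ _) (xor-identityʳ _)

    g-v : g v ≡ ρ* c S T
    g-v rewrite lookup-insert-other S v≢u | insert-remove-comm S v≢u
              | θ-v∉ c (S - v) T (lookup-remove-self S v) Tv | Sv | Tv =
      trans (xor-identityʳ _) (xor-identityʳ _)

  θ-homotopy-v∉ : ∀ c {S T} → lookup S v ≡ false → lookup T v ≡ false → HomotopyFormula c S T
  θ-homotopy-v∉ c {S} {T} Sv Tv =
    trans (cong₂ _xor_ (θ-v∉ (δ c) S T Sv Tv)
                       (δ-false (θ c) S T (λ i → θ-v∉ c (S - i) T (lookup-remove-absent S i Sv) Tv)
                                          (λ i → θ-v∉ c S (T - i) Sv (lookup-remove-absent T i Tv))))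
          (sym (trans (cong₂ (λ X Y → c S T xor c X Y) (ρ-v∉ Sv) (ρ-v∉ Tv)) (xor-same (c S T))))

  θ-homotopy-swap : ∀ c {S T} → Dom S T → HomotopyFormula (τ c) T S → HomotopyFormula c S T
  θ-homotopy-swap c {S} {T} dom = trans (cong₂ _xor_ θδ δθ)
    where
    θδ : θ (δ c) S T ≡ θ (δ (τ c)) T S
    θδ = sym (trans (θ-cong (δ-τ c) T S) (θ-τ (δ c) (Dom-sym dom)))
    δθ : δ (θ c) S T ≡ δ (θ (τ c)) T S
    δθ = sym (trans (δ-cong (θ (τ c)) (τ (θ c)) T S
                            (λ i _ → θ-τ c (Dom-faceˡ i (Dom-sym dom)))
                            (λ i _ → θ-τ c (Dom-faceʳ i (Dom-sym dom))))
                    (δ-τ (θ c) T S))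

  θ-homotopy : ∀ c {S T} → Dom S T → HomotopyFormula c S T
  θ-homotopy c dom@(u∉S , u∉T , _) with vSide dom
  ... | v∈ˡ Sv Tv = θ-homotopy-v∈ˡ c (∉⇒lookup u∉S) (∉⇒lookup u∉T) Sv Tv
  ... | v∈ʳ Sv Tv = θ-homotopy-swap c dom (θ-homotopy-v∈ˡ (τ c) (∉⇒lookup u∉T) (∉⇒lookup u∉S) Tv Sv)
  ... | v∉  Sv Tv = θ-homotopy-v∉ c Sv Tv

  δ-Q-inK : ∀ c {S T} → K S → K T → δ (Q c) S T ≡ false
  δ-Q-inK c {S} {T} kS kT = δ-false (Q c) S T (λ i → Q-inK c (K-closed (p─q⊆p S ⁅ i ⁆) kS) kT)
                                               (λ i → Q-inK c kS (K-closed (p─q⊆p T ⁅ i ⁆) kT))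

  P-δ-Q : ∀ c S T → P (δ (Q c)) S T ≡ false
  P-δ-Q c S T with K? S ×-dec K? T
  ... | yes (kS , kT) = trans (cong (inK₂ S T ∧_) (δ-Q-inK c kS kT)) (∧-zeroʳ _)
  ... | no ¬kST       = P-notInK (δ (Q c)) ¬kST

  δ-Q-δ-P : ∀ c S T → δ (Q (δ (P c))) S T ≡ δ (P (δ c)) S T
  δ-Q-δ-P c S T = begin
    δ (Q (δ (P c))) S T                          ≡⟨ δ-cong-≐ (Q≐id⊕P (δ (P c))) S T ⟩
    δ (δ (P c) ⊕ P (δ (P c))) S T                ≡⟨ δ-xor (δ (P c)) (P (δ (P c))) S T ⟩
    δ (δ (P c)) S T xor δ (P (δ (P c))) S T      ≡⟨ cong (_xor δ (P (δ (P c))) S T) (δ-δ (P c) S T) ⟩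
    δ (P (δ (P c))) S T                          ≡⟨ xor-identityʳ _ ⟨
    δ (P (δ (P c))) S T xor false                ≡⟨ cong (δ (P (δ (P c))) S T xor_) δPδQ≡false ⟨
    δ (P (δ (P c))) S T xor δ (P (δ (Q c))) S T  ≡⟨ δ-xor (P (δ (P c))) (P (δ (Q c))) S T ⟨
    δ (P (δ (P c)) ⊕ P (δ (Q c))) S T            ≡⟨ δ-cong-≐ Pδ-split S T ⟨
    δ (P (δ c)) S T                              ∎
    where
    open ≡-Reasoning
    δPδQ≡false : δ (P (δ (Q c))) S T ≡ false
    δPδQ≡false = δ-false (P (δ (Q c))) S T (λ i → P-δ-Q c (S - i) T) (λ i → P-δ-Q c S (T - i))
    Pδ-split : P (δ c) ≐ P (δ (P c)) ⊕ P (δ (Q c))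
    Pδ-split S T = trans (cong (inK₂ S T ∧_) (trans (δ-cong-≐ (P⊕Q c) S T) (δ-xor (P c) (Q c) S T)))
                         (P-xor (δ (P c)) (δ (Q c)) S T)

  P-θ-δ : ∀ c {S T} → Dom S T → P (θ (δ c)) S T ≡ ((P c ⊕ P (ρ* c)) ⊕ P (δ (θ c))) S T
  P-θ-δ c {S} {T} dom =
    trans (cong (inK₂ S T ∧_) (xor-solveʳ (δ (θ c) S T) (θ-homotopy c dom)))
          (trans (P-xor (c ⊕ ρ* c) (δ (θ c)) S T) (cong (_xor P (δ (θ c)) S T) (P-xor c (ρ* c) S T)))

  Λ-δ : ∀ c {S T} → Dom S T → δ (Λ c) S T ≡ Λ (δ c) S T
  Λ-δ c {S} {T} dom@(u∉S , u∉T , _) with K? S ×-dec K? T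
  ... | yes (kS , kT) =
    trans (δ-cong (Λ c) c S T (λ i _ → Λ-inK c (K-closed (p─q⊆p S ⁅ i ⁆) kS) kT)
                              (λ i _ → Λ-inK c kS (K-closed (p─q⊆p T ⁅ i ⁆) kT)))
          (sym (Λ-inK (δ c) kS kT))
  ... | no ¬kST = begin
    δ (Λ c) S T                           ≡⟨ δΛ-expand ⟩
    A xor (B xor G)                       ≡⟨ xor-rearrange A B F G ⟨
    (F xor B) xor ((A xor F) xor G)       ≡⟨ cong₂ _xor_ δρ*-split δPθδ-split ⟨
    δ (ρ* c) S T xor δ (P (θ (δ c))) S T  ≡⟨ cong (_xor δ (P (θ (δ c))) S T) (δ-ρ* c u∉S u∉T) ⟩
    ρ* (δ c) S T xor δ (P (θ (δ c))) S T  ≡⟨ Λ-notInK (δ c) ¬kST ⟨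
    Λ (δ c) S T                           ∎
    where
    open ≡-Reasoning
    A B F G : Bool
    A = δ (P c) S T
    B = δ (Q (ρ* c)) S T
    F = δ (P (ρ* c)) S T
    G = δ (P (δ (θ c))) S T

    δΛ-expand : δ (Λ c) S T ≡ A xor (B xor G)
    δΛ-expand =
      trans (δ-xor (P c) (Q (ρ* c ⊕ δ (P (θ c)))) S T)
            (cong (A xor_) (trans (δ-cong-≐ (Q-xor (ρ* c) (δ (P (θ c)))) S T)
                           (trans (δ-xor (Q (ρ* c)) (Q (δ (P (θ c)))) S T)
                                  (cong (B xor_) (δ-Q-δ-P (θ c) S T)))))

    δρ*-split : δ (ρ* c) S T ≡ F xor B
    δρ*-split = trans (δ-cong-≐ (P⊕Q (ρ* c)) S T) (δ-xor (P (ρ* c)) (Q (ρ* c)) S T)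

    δPθδ-split : δ (P (θ (δ c))) S T ≡ (A xor F) xor G
    δPθδ-split =
      trans (δ-cong (P (θ (δ c))) ((P c ⊕ P (ρ* c)) ⊕ P (δ (θ c))) S T
                    (λ i _ → P-θ-δ c (Dom-faceˡ i dom)) (λ i _ → P-θ-δ c (Dom-faceʳ i dom)))
            (trans (δ-xor (P c ⊕ P (ρ* c)) (P (δ (θ c))) S T)
                   (cong (_xor G) (δ-xor (P c) (P (ρ* c)) S T)))

  Λ-xor : ∀ c d S T → Λ (c ⊕ d) S T ≡ Λ c S T xor Λ d S T
  Λ-xor c d S T with K? S ×-dec K? T
  ... | yes (kS , kT) = trans (Λ-inK (c ⊕ d) kS kT) (sym (cong₂ _xor_ (Λ-inK c kS kT) (Λ-inK d kS kT)))
  ... | no ¬kST =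
    trans (Λ-notInK (c ⊕ d) ¬kST)
          (trans (cong (ρ* (c ⊕ d) S T xor_) (trans (δ-cong-≐ Pθ-xor S T) (δ-xor (P (θ c)) (P (θ d)) S T)))
          (trans (xor-interchange (ρ* c S T) (ρ* d S T) (δ (P (θ c)) S T) (δ (P (θ d)) S T))
                 (sym (cong₂ _xor_ (Λ-notInK c ¬kST) (Λ-notInK d ¬kST)))))
    where
    Pθ-xor : P (θ (c ⊕ d)) ≐ P (θ c) ⊕ P (θ d)
    Pθ-xor S T = trans (cong (inK₂ S T ∧_) (θ-xor c d S T)) (P-xor (θ c) (θ d) S T)

  Λ-τ : ∀ c {S T} → Dom S T → Λ (τ c) S T ≡ Λ c T S
  Λ-τ c {S} {T} dom with K? S ×-dec K? T
  ... | yes (kS , kT) = trans (Λ-inK (τ c) kS kT) (sym (Λ-inK c kT kS))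
  ... | no ¬kST =
    trans (Λ-notInK (τ c) ¬kST)
          (trans (cong (ρ* c T S xor_) (trans (δ-cong (P (θ (τ c))) (τ (P (θ c))) S T
                                                      (λ i _ → Pθ-τ (Dom-faceˡ i dom))
                                                      (λ i _ → Pθ-τ (Dom-faceʳ i dom)))
                                              (δ-τ (P (θ c)) S T)))
                 (sym (Λ-notInK c (λ (kT , kS) → ¬kST (kS , kT)))))
    where
    Pθ-τ : ∀ {S T} → Dom S T → P (θ (τ c)) S T ≡ P (θ c) T S
    Pθ-τ {S} {T} dom = trans (cong (inK₂ S T ∧_) (θ-τ c dom)) (P-τ (θ c) S T)

  K′ : Family n
  K′ = Contract K u v

  K′-avoids-u : ∀ {S} → K′ S → u ∉ S
  K′-avoids-u (inj₁ (u∉S , _))          = u∉S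
  K′-avoids-u (inj₂ (S₀ , _ , _ , refl)) = ∉-exchange-source S₀ u≢v

  K′-without-v : ∀ {S} → K′ S → v ∉ S → K S
  K′-without-v (inj₁ (_ , kS))           _   = kS
  K′-without-v (inj₂ (S₀ , _ , _ , refl)) v∉S = contradiction (lookup⇒∈ (lookup-exchange-target S₀)) v∉S

  K′-outside-K : ∀ {S} → K′ S → ¬ K S → lookup S v ≡ true × K (S ⟨ v ↦ u ⟩)
  K′-outside-K (inj₁ (_ , kS))               ¬kS = contradiction kS ¬kS
  K′-outside-K (inj₂ (S₀ , kS₀ , u∈S₀ , refl)) _   =
    lookup-exchange-target S₀ , K-closed (exchange-back-⊆ u∈S₀ (λ x∈ → x∈)) kS₀

  K′-small : ∀ {S} → K′ S → ∣ S ∣ ≤ 1 → K S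
  K′-small {S} kS′ ∣S∣≤1 with v ∈? S
  ... | no v∉S  = K′-without-v kS′ v∉S
  ... | yes v∈S = K-closed S⊆⁅v⁆ (proj₁ (proj₂ (proj₂ adm)))
    where
    S⊆⁅v⁆ : S ⊆ ⁅ v ⁆
    S⊆⁅v⁆ {x} x∈S with x ≟ v
    ... | yes refl = x∈⁅x⁆ v
    ... | no x≢v   = contradiction
      (≤-trans (≤-trans (s≤s (x∈p⇒∣p-x∣<∣p∣ (x∈p∧x≢y⇒x∈p-y x∈S x≢v))) (x∈p⇒∣p-x∣<∣p∣ v∈S)) ∣S∣≤1)
      λ { (s≤s ()) }

  simplex-Dom : ∀ {q S T} → Simplex* K′ q S T → Dom S T
  simplex-Dom (kS′ , kT′ , S∩T≡∅ , _) = K′-avoids-u kS′ , K′-avoids-u kT′ , λ (v∈S , v∈T) → S∩T≡∅ v v∈S v∈T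

  exchange-simplex : ∀ {q S T i} → Simplex* K′ q S T → K T → lookup S i ≡ true → K (S ⟨ i ↦ u ⟩) →
                     Simplex* K q (S ⟨ i ↦ u ⟩) T
  exchange-simplex {S = S} {T} (kS′ , kT′ , S∩T≡∅ , size) kT Si kZ =
    kZ , kT , exchange-disjoint S∩T≡∅ (K′-avoids-u kT′) ,
    trans (cong (_+ ∣ T ∣) (∣exchange∣ S Si (∉⇒lookup (K′-avoids-u kS′)))) size

  exchange-fill : ∀ {S i} → u ∉ S → lookup S v ≡ true → K (S ⟨ v ↦ u ⟩) →
                  i ≢ v → lookup S i ≡ true → K (S - i) → K (S ⟨ i ↦ u ⟩)
  exchange-fill {S} {i} u∉S Sv kρS i≢v Si kS-i =
    admissible-fill K-closed K? adm (S ⟨ i ↦ u ⟩)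
      (lookup⇒∈ (lookup-exchange-target S))
      (lookup⇒∈ (trans (lookup-exchange-other S (i≢v ∘ sym) v≢u) Sv))
      (subst K (sym (insert-remove-self (S - i) (lookup-remove-absent S i (∉⇒lookup u∉S)))) kS-i)
      (K-closed (exchange-remove-⊆ S) kρS)
      (S ⟨ v ↦ u ⟩ , kρS , ≤-reflexive (trans (∣exchange∣ S Si (∉⇒lookup u∉S))
                                              (sym (∣exchange∣ S Sv (∉⇒lookup u∉S)))))

  Λ-cong-outside : ∀ {q c c′ S T} → EqOn K q c c′ → Simplex* K′ q S T → ¬ K S → Λ c S T ≡ Λ c′ S T
  Λ-cong-outside {q} {c} {c′} {S} {T} c≈c′ s@(kS′ , kT′ , S∩T≡∅ , _) ¬kS =
    trans (Λ-notInK c (¬kS ∘ proj₁)) (trans (cong₂ _xor_ ρ*-part δ-part) (sym (Λ-notInK c′ (¬kS ∘ proj₁))))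
    where
    Sv : lookup S v ≡ true
    Sv = proj₁ (K′-outside-K kS′ ¬kS)
    kρS : K (S ⟨ v ↦ u ⟩)
    kρS = proj₂ (K′-outside-K kS′ ¬kS)
    v∉T : v ∉ T
    v∉T v∈T = S∩T≡∅ v (lookup⇒∈ Sv) v∈T
    kT : K T
    kT = K′-without-v kT′ v∉T
    u∉S : u ∉ S
    u∉S = K′-avoids-u kS′

    ρ*-part : ρ* c S T ≡ ρ* c′ S T
    ρ*-part rewrite ρ-v∈ {S} Sv | ρ-v∉ {T} (∉⇒lookup v∉T) =
      c≈c′ (S ⟨ v ↦ u ⟩) T (exchange-simplex s kT Sv kρS)

    faceˡ : ∀ i → lookup S i ≡ true → P (θ c) (S - i) T ≡ P (θ c′) (S - i) T
    faceˡ i Si with i ≟ v | K? (S - i)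
    ... | yes refl | _        = cong (_ ∧_)
      (trans (θ-v∉ c (S - v) T (lookup-remove-self S v) (∉⇒lookup v∉T))
             (sym (θ-v∉ c′ (S - v) T (lookup-remove-self S v) (∉⇒lookup v∉T))))
    ... | no _     | no _     = refl
    ... | no i≢v   | yes kS-i = cong (_ ∧_)
      (trans (θ-v∈ˡ c (S - i) T S-i∋v)
             (trans (c≈c′ (S ⟨ i ↦ u ⟩) T (exchange-simplex s kT Si (exchange-fill u∉S Sv kρS i≢v Si kS-i)))
                    (sym (θ-v∈ˡ c′ (S - i) T S-i∋v))))
      where
      S-i∋v : lookup (S - i) v ≡ true
      S-i∋v = trans (lookup-remove-other S (i≢v ∘ sym)) Sv

    δ-part : δ (P (θ c)) S T ≡ δ (P (θ c′)) S T
    δ-part = δ-cong (P (θ c)) (P (θ c′)) S T faceˡ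
      (λ i _ → trans (P-notInK (θ c) (¬kS ∘ proj₁)) (sym (P-notInK (θ c′) (¬kS ∘ proj₁))))

  Λ-cong : ∀ {q c c′} → EqOn K q c c′ → EqOn K′ q (Λ c) (Λ c′)
  Λ-cong {c = c} {c′} c≈c′ S T s@(_ , _ , S∩T≡∅ , size) = by-cases (K? S) (K? T)
    where
    open ≡-Reasoning
    by-cases : Dec (K S) → Dec (K T) → Λ c S T ≡ Λ c′ S T
    by-cases (yes kS) (yes kT) =
      trans (Λ-inK c kS kT) (trans (c≈c′ S T (kS , kT , S∩T≡∅ , size)) (sym (Λ-inK c′ kS kT)))
    by-cases (no ¬kS) _        = Λ-cong-outside c≈c′ s ¬kS
    by-cases (yes _)  (no ¬kT) = begin
      Λ c S T       ≡⟨ Λ-τ c (Dom-sym (simplex-Dom s)) ⟨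
      Λ (τ c) T S   ≡⟨ Λ-cong-outside (EqOn-τ c≈c′) (Simplex*-sym s) ¬kT ⟩
      Λ (τ c′) T S  ≡⟨ Λ-τ c′ (Dom-sym (simplex-Dom s)) ⟩
      Λ c′ S T      ∎

  vertex-in-K : ∀ {S T} → Simplex* K′ 0 S T → Simplex* K 0 S T
  vertex-in-K {S} {T} (kS′ , kT′ , S∩T≡∅ , size) =
    K′-small kS′ (subst (∣ S ∣ ≤_) size (m≤m+n ∣ S ∣ ∣ T ∣)) ,
    K′-small kT′ (subst (∣ T ∣ ≤_) size (m≤n+m ∣ T ∣ ∣ S ∣)) , S∩T≡∅ , size

  contraction : EquivariantCochainMap K K′
  contraction = record
    { map        = Λ
    ; map-cong   = Λ-cong
    ; map-xor    = λ c d S T _ → Λ-xor c d S T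
    ; map-τ      = λ c S T s → Λ-τ c (simplex-Dom s)
    ; map-δ      = λ c S T s → Λ-δ c (simplex-Dom s)
    ; map-vertex = λ {c} c≈d S T s →
        let s₀ = vertex-in-K s in trans (Λ-inK c (proj₁ s₀) (proj₁ (proj₂ s₀))) (c≈d S T s₀)
    }

¬¬-decidable : ∀ {n} (P : Subset n → Set) → ¬ ¬ (∀ S → Dec (P S))
¬¬-decidable {zero}  P ¬dec = ¬¬-excluded-middle (λ P[]? → ¬dec (λ { [] → P[]? }))
¬¬-decidable {suc n} P ¬dec =
  ¬¬-decidable (P ∘ (true ∷_)) λ P₁? →
  ¬¬-decidable (P ∘ (false ∷_)) λ P₀? →
  ¬dec (λ { (true ∷ S) → P₁? S ; (false ∷ S) → P₀? S })

theorem1p1 : (n : ℕ) (H K : Family n) → IsComplex H → IsComplex K →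
    (m : ℕ) → Minor H K → SmNonzero H m → SmNonzero K m
theorem1p1 n H K _ K-closed m H<K SmH≢0 = go K-closed H<K
  where
  go : ∀ {K} → IsComplex K → Minor H K → SmNonzero K m
  go _ (done H≡K) = SmH≢0 ∘ map-SmZero (restriction (λ S → proj₁ (H≡K S))) m
  go K-closed (contr u v adm H<K′) SmK≡0 = ¬¬-decidable _ λ K? →
    go (Contract-closed K-closed (proj₁ adm)) H<K′
       (map-SmZero (Contraction.contraction K-closed K? adm) m SmK≡0)
  go _ (del K′ K′-closed K′⊆K H<K′) = go K′-closed H<K′ ∘ map-SmZero (restriction K′⊆K) m
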